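{- Let $R$ be a commutative ring with identity, and let $H_1,\dots,H_m$ be hyperplanes in $R^n$, where $H_i$ is the zero set of $(\mathbf a^i,\mathbf x)-b_i=a^i_1x_1+\cdots+a^i_nx_n-b_i$ with $a^i_j,b_i\in R$. Suppose that $H_1,\dots,H_m$ cover all vertices of the unit cube $\{0,1\}^n\subseteq R^n$ except $\mathbf 0$ (i.e. every $\mathbf s\in\{0,1\}^n\setminus\{\mathbf 0\}$ lies in some $H_i$). If $\prod_{i=1}^m b_i\neq 0$, then $m\ge n$. -}

module Defs where

open import Level using (Level)
open import Data.Nat using (ℕ; zero; suc)
open import Data.Fin using (Fin; zero; suc)
open import Data.Bool using (Bool; true; false)
open import Algebra.Bundles using (CommutativeRing)

module _ {c ℓ : Level} (R : CommutativeRing c ℓ) where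
  open CommutativeRing R using (Carrier; _+_; _*_; _-_; _≈_; 0#; 1#)

  ∑ : ∀ {n} → (Fin n → Carrier) → Carrier
  ∑ {zero}  f = 0#
  ∑ {suc n} f = f zero + ∑ (λ j → f (suc j))

  ∏ : ∀ {m} → (Fin m → Carrier) → Carrier
  ∏ {zero}  f = 1#
  ∏ {suc m} f = f zero * ∏ (λ i → f (suc i))

  ⟦_⟧ : Bool → Carrier
  ⟦ true ⟧  = 1#
  ⟦ false ⟧ = 0#

  affine : ∀ {n} → (Fin n → Carrier) → Carrier → (Fin n → Carrier) → Carrier
  affine a b x = ∑ (λ j → a j * x j) - b

  OnHyperplane : ∀ {n} → (Fin n → Carrier) → Carrier → (Fin n → Carrier) → Set ℓ
  OnHyperplane a b x = affine a b x ≈ 0#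

-- Let P s = ∏ᵢ ((aⁱ, s) − bᵢ), a product of m affine functions on the cube {0,1}ⁿ. The n-fold
-- difference D f = Σ_s (−1)^|s| f s kills every function of degree less than n (each difference
-- in one coordinate lowers the degree), while for a function vanishing on every nonzero vertex it
-- returns the value at the origin. If the hyperplanes cover the punctured cube and m < n, then
-- ∏ᵢ (−bᵢ) = P 0 = D P = 0, hence ∏ᵢ bᵢ = 0.
module Submission where

open import Defs
open import Level using (Level; _⊔_)
open import Data.Nat using (ℕ; zero; suc; _≤_; _<_; s≤s)
open import Data.Nat.Properties using (≮⇒≥)
open import Data.Fin using (Fin; zero; suc)
open import Data.Bool using (Bool; true; false)
open import Data.Product using (∃; _,_)
open import Data.Vec.Functional using ([]; _∷_; tail)
open import Relation.Binary.PropositionalEquality as ≡ using (_≡_)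
open import Relation.Nullary using (¬_)
open import Algebra.Bundles using (CommutativeRing)
import Algebra.Properties.CommutativeMonoid.Sum as SumProperties
import Algebra.Properties.CommutativeSemigroup as CommutativeSemigroupProperties
import Algebra.Properties.Ring as RingProperties
import Relation.Binary.Reasoning.Setoid as SetoidReasoning

module _ {c ℓ : Level} (R : CommutativeRing c ℓ) where
  open CommutativeRing R hiding (zero)
  open RingProperties ring using (x[y-z]≈xy-xz; -1*x≈-x; -‿distribˡ-*; -0#≈0#; -‿+-comm; -‿involutive; x≈y⇒x∙y⁻¹≈ε)
  open CommutativeSemigroupProperties +-commutativeSemigroup using (interchange; xy∙z≈y∙xz; x∙yz≈y∙xz)
  open SetoidReasoning setoid
  module Sum = SumProperties +-commutativeMonoid
  module Product = SumProperties *-commutativeMonoid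

  ∑≡sum : ∀ {n} (f : Fin n → Carrier) → ∑ R f ≡ Sum.sum f
  ∑≡sum {zero}  f = ≡.refl
  ∑≡sum {suc n} f = ≡.cong (f zero +_) (∑≡sum (tail f))

  ∏≡product : ∀ {m} (f : Fin m → Carrier) → ∏ R f ≡ Product.sum f
  ∏≡product {zero}  f = ≡.refl
  ∏≡product {suc m} f = ≡.cong (f zero *_) (∏≡product (tail f))

  ∏-cong : ∀ {m} {f g : Fin m → Carrier} → (∀ i → f i ≈ g i) → ∏ R f ≈ ∏ R g
  ∏-cong {f = f} {g} f≈g = begin
    ∏ R f          ≡⟨ ∏≡product f ⟩
    Product.sum f  ≈⟨ Product.sum-cong-≋ f≈g ⟩
    Product.sum g  ≡⟨ ∏≡product g ⟨
    ∏ R g          ∎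

  ∏-zero : ∀ {m} (f : Fin m → Carrier) i → f i ≈ 0# → ∏ R f ≈ 0#
  ∏-zero f zero    fi≈0 = trans (*-congʳ fi≈0) (zeroˡ _)
  ∏-zero f (suc i) fi≈0 = trans (*-congˡ (∏-zero (tail f) i fi≈0)) (zeroʳ _)

  ∏-neg : ∀ {m} (f : Fin m → Carrier) → ∏ R f ≈ ∏ R {m} (λ _ → - 1#) * ∏ R (λ i → - f i)
  ∏-neg {m} f = begin
    ∏ R f                                  ≈⟨ ∏-cong {m} (λ i → sym (-1*-x≈x (f i))) ⟩
    ∏ R (λ i → - 1# * - f i)               ≡⟨ ∏≡product {m} _ ⟩
    Product.sum (λ i → - 1# * - f i)       ≈⟨ Product.∑-distrib-+ (λ _ → - 1#) (λ i → - f i) ⟩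
    Product.sum {m} (λ _ → - 1#) * Product.sum (λ i → - f i)
      ≡⟨ ≡.cong₂ _*_ (∏≡product {m} _) (∏≡product {m} _) ⟨
    ∏ R {m} (λ _ → - 1#) * ∏ R (λ i → - f i) ∎
    where
    -1*-x≈x : ∀ x → - 1# * - x ≈ x
    -1*-x≈x x = trans (-1*x≈-x (- x)) (-‿involutive x)

  Cube : ℕ → Set
  Cube n = Fin n → Bool

  origin : ∀ n → Cube n
  origin zero    = []
  origin (suc n) = false ∷ origin n

  ⟦_⟧ᵛ : ∀ {n} → Cube n → Fin n → Carrier
  ⟦ s ⟧ᵛ j = ⟦_⟧ R (s j)

  ⟦origin⟧ᵛ≡0 : ∀ n (j : Fin n) → ⟦ origin n ⟧ᵛ j ≡ 0#
  ⟦origin⟧ᵛ≡0 (suc n) zero    = ≡.refl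
  ⟦origin⟧ᵛ≡0 (suc n) (suc j) = ⟦origin⟧ᵛ≡0 n j

  -- Written with + k rather than − b: affine R a b ⟦ s ⟧ᵛ is affineMap a (- b) s, definitionally.
  affineMap : ∀ {n} → (Fin n → Carrier) → Carrier → Cube n → Carrier
  affineMap a k s = ∑ R (λ j → a j * ⟦ s ⟧ᵛ j) + k

  affineMap-∷ : ∀ {n} (a : Fin (suc n) → Carrier) k b x →
                affineMap a k (b ∷ x) ≈ affineMap (tail a) (a zero * ⟦_⟧ R b + k) x
  affineMap-∷ a k b x = xy∙z≈y∙xz (a zero * ⟦_⟧ R b) (∑ R (λ j → a (suc j) * ⟦ x ⟧ᵛ j)) k

  affineMap-false : ∀ {n} (a : Fin (suc n) → Carrier) k x →
                    affineMap a k (false ∷ x) ≈ affineMap (tail a) k x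
  affineMap-false a k x = trans (affineMap-∷ a k false x)
    (+-congˡ (trans (+-congʳ (zeroʳ (a zero))) (+-identityˡ k)))

  affineMap-true : ∀ {n} (a : Fin (suc n) → Carrier) k x →
                   affineMap a k (true ∷ x) ≈ a zero + affineMap (tail a) k x
  affineMap-true a k x = begin
    affineMap a k (true ∷ x)                     ≈⟨ affineMap-∷ a k true x ⟩
    S + (a zero * 1# + k)                        ≈⟨ +-congˡ (+-congʳ (*-identityʳ (a zero))) ⟩
    S + (a zero + k)                             ≈⟨ x∙yz≈y∙xz S (a zero) k ⟩
    a zero + (S + k)                             ∎
    where
    S = ∑ R (λ j → a (suc j) * ⟦ x ⟧ᵛ j)

  data Poly≤ {n : ℕ} : ℕ → (Cube n → Carrier) → Set (c ⊔ ℓ) where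
    const     : ∀ {d} k → Poly≤ d (λ _ → k)
    resp      : ∀ {d f g} → (∀ s → f s ≈ g s) → Poly≤ d f → Poly≤ d g
    add       : ∀ {d f g} → Poly≤ d f → Poly≤ d g → Poly≤ d (λ s → f s + g s)
    scale     : ∀ {d f} k → Poly≤ d f → Poly≤ d (λ s → k * f s)
    mulAffine : ∀ {d f} a k → Poly≤ d f → Poly≤ (suc d) (λ s → affineMap a k s * f s)

  restrict : ∀ {n d f} b → Poly≤ {suc n} d f → Poly≤ {n} d (λ x → f (b ∷ x))
  restrict b (const k)         = const k
  restrict b (resp f≈g p)      = resp (λ x → f≈g (b ∷ x)) (restrict b p)
  restrict b (add p q)         = add (restrict b p) (restrict b q)
  restrict b (scale k p)       = scale k (restrict b p)
  restrict b (mulAffine a k p) =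
    resp (λ x → *-congʳ (sym (affineMap-∷ a k b x)))
         (mulAffine (tail a) (a zero * ⟦_⟧ R b + k) (restrict b p))

  Δ : ∀ {n} → (Cube (suc n) → Carrier) → Cube n → Carrier
  Δ f x = f (false ∷ x) - f (true ∷ x)

  Δ-resp : ∀ {n} {f g : Cube (suc n) → Carrier} → (∀ s → f s ≈ g s) → ∀ x → Δ f x ≈ Δ g x
  Δ-resp f≈g x = +-cong (f≈g (false ∷ x)) (-‿cong (f≈g (true ∷ x)))

  Δ-+ : ∀ {n} (f g : Cube (suc n) → Carrier) x → Δ (λ s → f s + g s) x ≈ Δ f x + Δ g x
  Δ-+ f g x = begin
    (f₀ + g₀) - (f₁ + g₁)      ≈⟨ +-congˡ (-‿+-comm f₁ g₁) ⟨
    (f₀ + g₀) + (- f₁ + - g₁)  ≈⟨ interchange f₀ g₀ (- f₁) (- g₁) ⟩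
    (f₀ - f₁) + (g₀ - g₁)      ∎
    where
    f₀ = f (false ∷ x); f₁ = f (true ∷ x); g₀ = g (false ∷ x); g₁ = g (true ∷ x)

  Δ-* : ∀ {n} k (f : Cube (suc n) → Carrier) x → Δ (λ s → k * f s) x ≈ k * Δ f x
  Δ-* k f x = sym (x[y-z]≈xy-xz k (f (false ∷ x)) (f (true ∷ x)))

  -- Leibniz rule: both terms have degree at most that of f, so Δ lowers the degree.
  Δ-mulAffine : ∀ {n} a k (f : Cube (suc n) → Carrier) x →
                Δ (λ s → affineMap a k s * f s) x
                  ≈ affineMap (tail a) k x * Δ f x + (- a zero) * f (true ∷ x)
  Δ-mulAffine a k f x = begin
    L₀ * f₀ - L₁ * f₁              ≈⟨ +-cong (*-congʳ (affineMap-false a k x))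
                                              (-‿cong (*-congʳ (affineMap-true a k x))) ⟩
    u * f₀ - (a₀ + u) * f₁          ≈⟨ +-congˡ (-‿cong (distribʳ f₁ a₀ u)) ⟩
    u * f₀ - (a₀ * f₁ + u * f₁)     ≈⟨ +-congˡ (-‿+-comm (a₀ * f₁) (u * f₁)) ⟨
    u * f₀ + (- (a₀ * f₁) + - (u * f₁)) ≈⟨ +-congˡ (+-comm _ _) ⟩
    u * f₀ + (- (u * f₁) + - (a₀ * f₁)) ≈⟨ +-assoc _ _ _ ⟨
    (u * f₀ - u * f₁) - a₀ * f₁     ≈⟨ +-cong (x[y-z]≈xy-xz u f₀ f₁) (sym (-‿distribˡ-* a₀ f₁)) ⟨
    u * (f₀ - f₁) + (- a₀) * f₁     ∎
    where
    a₀ = a zero; u = affineMap (tail a) k x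
    L₀ = affineMap a k (false ∷ x); L₁ = affineMap a k (true ∷ x)
    f₀ = f (false ∷ x); f₁ = f (true ∷ x)

  Δ-degree0 : ∀ {n f} → Poly≤ {suc n} 0 f → ∀ x → Δ f x ≈ 0#
  Δ-degree0 (const k)    x = -‿inverseʳ k
  Δ-degree0 (resp f≈g p) x = trans (sym (Δ-resp f≈g x)) (Δ-degree0 p x)
  Δ-degree0 (add {f = f} {g} p q) x =
    trans (Δ-+ f g x) (trans (+-cong (Δ-degree0 p x) (Δ-degree0 q x)) (+-identityˡ 0#))
  Δ-degree0 (scale {f = f} k p) x = trans (Δ-* k f x) (trans (*-congˡ (Δ-degree0 p x)) (zeroʳ k))

  Δ-degree : ∀ {n d f} → Poly≤ {suc n} (suc d) f → Poly≤ {n} d (Δ f)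
  Δ-degree (const k)    = const (k - k)
  Δ-degree (resp f≈g p) = resp (Δ-resp f≈g) (Δ-degree p)
  Δ-degree (add {f = f} {g} p q) = resp (λ x → sym (Δ-+ f g x)) (add (Δ-degree p) (Δ-degree q))
  Δ-degree (scale {f = f} k p) = resp (λ x → sym (Δ-* k f x)) (scale k (Δ-degree p))
  Δ-degree (mulAffine {d = zero} {g} a k p) = resp leibniz (scale (- a zero) (restrict true p))
    where
    leibniz : ∀ x → - a zero * g (true ∷ x) ≈ Δ (λ s → affineMap a k s * g s) x
    leibniz x = sym (begin
      Δ (λ s → affineMap a k s * g s) x                       ≈⟨ Δ-mulAffine a k g x ⟩
      affineMap (tail a) k x * Δ g x + - a zero * g (true ∷ x) ≈⟨ +-congʳ (*-congˡ (Δ-degree0 p x)) ⟩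
      affineMap (tail a) k x * 0# + - a zero * g (true ∷ x)    ≈⟨ +-congʳ (zeroʳ _) ⟩
      0# + - a zero * g (true ∷ x)                             ≈⟨ +-identityˡ _ ⟩
      - a zero * g (true ∷ x)                                  ∎)
  Δ-degree (mulAffine {d = suc d} {g} a k p) =
    resp (λ x → sym (Δ-mulAffine a k g x))
         (add (mulAffine (tail a) k (Δ-degree p)) (scale (- a zero) (restrict true p)))

  D : ∀ n → (Cube n → Carrier) → Carrier
  D zero    f = f []
  D (suc n) f = D n (Δ f)

  D-zero : ∀ n {f} → (∀ s → f s ≈ 0#) → D n f ≈ 0#
  D-zero zero    f≈0 = f≈0 []
  D-zero (suc n) f≈0 = D-zero n (λ x → x≈y⇒x∙y⁻¹≈ε (trans (f≈0 (false ∷ x)) (sym (f≈0 (true ∷ x)))))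

  D-degree< : ∀ {n d f} → Poly≤ {n} d f → d < n → D n f ≈ 0#
  D-degree< {suc n} {zero}  p _           = D-zero n (Δ-degree0 p)
  D-degree< {suc n} {suc d} p (s≤s d<n) = D-degree< (Δ-degree p) d<n

  VanishesOffOrigin : ∀ {n} → (Cube n → Carrier) → Set ℓ
  VanishesOffOrigin {n} f = (s : Cube n) → ∃ (λ j → s j ≡ true) → f s ≈ 0#

  D-vanishesOffOrigin : ∀ n {f} → VanishesOffOrigin f → D n f ≈ f (origin n)
  D-vanishesOffOrigin zero    _      = refl
  D-vanishesOffOrigin (suc n) {f} f≈0 = begin
    D n (Δ f)                                    ≈⟨ D-vanishesOffOrigin n Δf≈0 ⟩
    f (origin (suc n)) - f (true ∷ origin n)     ≈⟨ +-congˡ (-‿cong (f≈0 _ (zero , ≡.refl))) ⟩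
    f (origin (suc n)) - 0#                      ≈⟨ +-congˡ -0#≈0# ⟩
    f (origin (suc n)) + 0#                      ≈⟨ +-identityʳ _ ⟩
    f (origin (suc n))                           ∎
    where
    Δf≈0 : VanishesOffOrigin (Δ f)
    Δf≈0 s (j , sj) = x≈y⇒x∙y⁻¹≈ε (trans (f≈0 _ (suc j , sj)) (sym (f≈0 _ (zero , ≡.refl))))

  hyperplaneProduct : ∀ {n m} → (Fin m → Fin n → Carrier) → (Fin m → Carrier) → Cube n → Carrier
  hyperplaneProduct a b s = ∏ R (λ i → affine R (a i) (b i) ⟦ s ⟧ᵛ)

  hyperplaneProduct-degree : ∀ {n} m a b → Poly≤ m (hyperplaneProduct {n} {m} a b)
  hyperplaneProduct-degree zero    a b = const 1#
  hyperplaneProduct-degree (suc m) a b =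
    mulAffine (a zero) (- b zero) (hyperplaneProduct-degree m (tail a) (tail b))

  affine-origin : ∀ {n} a b → affine R {n} a b ⟦ origin n ⟧ᵛ ≈ - b
  affine-origin {n} a b = begin
    ∑ R (λ j → a j * ⟦ origin n ⟧ᵛ j) - b      ≡⟨ ≡.cong (_- b) (∑≡sum {n} _) ⟩
    Sum.sum (λ j → a j * ⟦ origin n ⟧ᵛ j) - b  ≈⟨ +-congʳ (Sum.sum-cong-≋ aⱼ*0≈0) ⟩
    Sum.sum {n} (λ _ → 0#) - b                 ≈⟨ +-congʳ (Sum.sum-replicate-zero n) ⟩
    0# - b                                     ≈⟨ +-identityˡ (- b) ⟩
    - b                                        ∎
    where
    aⱼ*0≈0 : ∀ j → a j * ⟦ origin n ⟧ᵛ j ≈ 0#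
    aⱼ*0≈0 j = trans (*-congˡ (reflexive (⟦origin⟧ᵛ≡0 n j))) (zeroʳ (a j))

  CoversPuncturedCube : ∀ {n m} → (Fin m → Fin n → Carrier) → (Fin m → Carrier) → Set ℓ
  CoversPuncturedCube {n} a b =
    (s : Cube n) → ∃ (λ j → s j ≡ true) → ∃ (λ i → OnHyperplane R (a i) (b i) ⟦ s ⟧ᵛ)

  covering⇒∏≈0 : ∀ {n m} (a : Fin m → Fin n → Carrier) b →
                 CoversPuncturedCube a b → m < n → ∏ R b ≈ 0#
  covering⇒∏≈0 {n} {m} a b covers m<n = begin
    ∏ R b                                    ≈⟨ ∏-neg b ⟩
    ∏ R {m} (λ _ → - 1#) * ∏ R (λ i → - b i) ≈⟨ *-congˡ ∏-b≈0 ⟩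
    ∏ R {m} (λ _ → - 1#) * 0#                ≈⟨ zeroʳ _ ⟩
    0#                                       ∎
    where
    P = hyperplaneProduct a b
    P-vanishesOffOrigin : VanishesOffOrigin P
    P-vanishesOffOrigin s nonzero = let i , onHᵢ = covers s nonzero in ∏-zero _ i onHᵢ
    ∏-b≈0 : ∏ R (λ i → - b i) ≈ 0#
    ∏-b≈0 = begin
      ∏ R (λ i → - b i)  ≈⟨ ∏-cong (λ i → affine-origin (a i) (b i)) ⟨
      P (origin n)       ≈⟨ D-vanishesOffOrigin n P-vanishesOffOrigin ⟨
      D n P              ≈⟨ D-degree< (hyperplaneProduct-degree m a b) m<n ⟩
      0#                 ∎

theorem6 : ∀ {c ℓ : Level} (R : CommutativeRing c ℓ) (n m : ℕ)
           (a : Fin m → Fin n → CommutativeRing.Carrier R)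
           (b : Fin m → CommutativeRing.Carrier R) →
           ((s : Fin n → Bool) → ∃ (λ j → s j ≡ true) →
             ∃ (λ i → OnHyperplane R (a i) (b i) (λ j → ⟦_⟧ R (s j)))) →
           ¬ (CommutativeRing._≈_ R (∏ R b) (CommutativeRing.0# R)) →
           n ≤ m
theorem6 R n m a b covers ∏b≉0 = ≮⇒≥ (λ m<n → ∏b≉0 (covering⇒∏≈0 R a b covers m<n))
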